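{- Let an SSTP instance be given: an undirected graph $G=(V,E)$, scenarios $k\in\mathcal K=\{1,\dots,K\}$ with terminal sets $\emptyset\ne T^k\subseteq V$ and chosen roots $r^k\in T^k$; let $T^k_r=T^k\setminus\{r^k\}$, $V^k_r=V\setminus\{r^k\}$, $A$ the arc set of the bidirection of $G$, and $\delta^-(S)=\{(i,j)\in A:i\notin S,j\in S\}$. Let $P_{sdc1}$ be the set of $(x^0,z^{1\dots K})\in[0,1]^{E}\times[0,1]^{|A|K}$ with $\sum_{(i,j)\in\delta^-(S)}(x^0_{\{i,j\}}+z^k_{ij})\ge1$ for all $k$ and all $S\subseteq V^k_r$ with $S\cap T^k_r\ne\emptyset$, and $z^k_{ij}+z^k_{ji}\le1$ for all $k$, $(i,j)\in A$. Let $P_{sdc2}$ be the set of $(x^0,y^{1\dots K})\in[0,1]^{E}\times[0,1]^{|A|K}$ with $\sum_{(i,j)\in\delta^-(S)}y^k_{ij}\ge1$ for all $k$ and all $S\subseteq V^k_r$ with $S\cap T^k_r\ne\emptyset$, $y^k_{ij}+y^k_{ji}\ge x^0_e$ for all $k$ and $e=\{i,j\}\in E$, and $y^k_{ij}+y^k_{ji}\le1$ for all $k$, $(i,j)\in A$. Define the projections onto undirected edge variables $x^{0\dots K}=(x^0,x^1,\dots,x^K)$: $\mathrm{proj}(P_{sdc1})=\{x^{0\dots K}:\exists z^{1\dots K},(x^0,z^{1\dots K})\in P_{sdc1},\ x^k_e=z^k_{ij}+z^k_{ji}\ \forall k,\forall e=\{i,j\}\}$ and $\mathrm{proj}(P_{sdc2})=\{x^{0\dots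 K}:\exists y^{1\dots K},(x^0,y^{1\dots K})\in P_{sdc2},\ x^k_e=y^k_{ij}+y^k_{ji}-x^0_e\ \forall k,\forall e=\{i,j\}\}$. Then for every such instance $\mathrm{proj}(P_{sdc1})\supseteq\mathrm{proj}(P_{sdc2})$, and there exist instances for which the inclusion is strict.
   Formalization: The points of $P_{sdc1}$, $P_{sdc2}$ and of their projections, including $x^{0\dots K}$, $z^{1\dots K}$ and $y^{1\dots K}$, have rational coordinates. -}

module Defs where

open import Data.Nat using (ℕ; zero; suc; _≤_)
open import Data.Fin using (Fin; zero; suc)
open import Data.Bool using (Bool; true; false; not; _∧_; if_then_else_)
open import Data.Product using (_×_; _,_; proj₁; proj₂; ∃; ∃-syntax)
open import Data.Sum using (_⊎_)
open import Data.Vec using (lookup)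
open import Data.Fin.Subset using (Subset; _∈_; _∉_)
open import Data.Rational using (ℚ; 0ℚ; 1ℚ; _+_; _-_) renaming (_≤_ to _≤ℚ_)
open import Relation.Binary.PropositionalEquality using (_≡_; _≢_)
open import Relation.Nullary using (¬_)

sumFin : (m : ℕ) → (Fin m → ℚ) → ℚ
sumFin zero    f = 0ℚ
sumFin (suc m) f = f zero + sumFin m (λ i → f (suc i))

sumBool : (Bool → ℚ) → ℚ
sumBool f = f true + f false

SameEnds : {n : ℕ} → Fin n × Fin n → Fin n × Fin n → Set
SameEnds (a , b) (c , d) = ((a ≡ c) × (b ≡ d)) ⊎ ((a ≡ d) × (b ≡ c))

-- An SSTP instance: finite simple undirected graph G = (V,E) with V = Fin n,
-- E = Fin m (edge e has endpoints ends e), K ≥ 1 scenarios with terminal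
-- sets T k and roots r k ∈ T k (so T k is nonempty).
record SSTP : Set where
  field
    n      : ℕ
    m      : ℕ
    ends   : Fin m → Fin n × Fin n
    noLoop : ∀ e → proj₁ (ends e) ≢ proj₂ (ends e)
    simple : ∀ e f → SameEnds (ends e) (ends f) → e ≡ f
    K      : ℕ
    K≥1    : 1 ≤ K
    T      : Fin K → Subset n
    r      : Fin K → Fin n
    r∈T    : ∀ k → r k ∈ T k

  -- Arcs of the bidirection of G: an arc is (e , b); for e = {i,j} with
  -- ends e = (i , j), (e , true) is (i,j) and (e , false) is (j,i).
  tail : Fin m → Bool → Fin n
  tail e true  = proj₁ (ends e)
  tail e false = proj₂ (ends e)

  head : Fin m → Bool → Fin n
  head e true  = proj₂ (ends e)
  head e false = proj₁ (ends e)

  inδ⁻ : Subset n → Fin m → Bool → Bool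
  inδ⁻ S e b = not (lookup S (tail e b)) ∧ lookup S (head e b)

  δ⁻sum : Subset n → (Fin m → Bool → ℚ) → ℚ
  δ⁻sum S f = sumFin m (λ e → sumBool (λ b → if inδ⁻ S e b then f e b else 0ℚ))

  CutSet : Fin K → Subset n → Set
  CutSet k S = (r k ∉ S) × (∃[ t ] (t ∈ S × t ∈ T k × t ≢ r k))

  InUnit : ℚ → Set
  InUnit q = (0ℚ ≤ℚ q) × (q ≤ℚ 1ℚ)

  InPsdc1 : (Fin m → ℚ) → (Fin K → Fin m → Bool → ℚ) → Set
  InPsdc1 x0 z =
    (∀ e → InUnit (x0 e)) ×
    (∀ k e b → InUnit (z k e b)) ×
    (∀ k S → CutSet k S → 1ℚ ≤ℚ δ⁻sum S (λ e b → x0 e + z k e b)) ×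
    (∀ k e → (z k e true + z k e false) ≤ℚ 1ℚ)

  InPsdc2 : (Fin m → ℚ) → (Fin K → Fin m → Bool → ℚ) → Set
  InPsdc2 x0 y =
    (∀ e → InUnit (x0 e)) ×
    (∀ k e b → InUnit (y k e b)) ×
    (∀ k S → CutSet k S → 1ℚ ≤ℚ δ⁻sum S (λ e b → y k e b)) ×
    (∀ k e → x0 e ≤ℚ (y k e true + y k e false)) ×
    (∀ k e → (y k e true + y k e false) ≤ℚ 1ℚ)

  -- x⁰…ᴷ = (x⁰ , xs) with xs k = xᵏ
  InProj1 : (Fin m → ℚ) → (Fin K → Fin m → ℚ) → Set
  InProj1 x0 xs = ∃[ z ] (InPsdc1 x0 z × (∀ k e → xs k e ≡ z k e true + z k e false))

  InProj2 : (Fin m → ℚ) → (Fin K → Fin m → ℚ) → Set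
  InProj2 x0 xs = ∃[ y ] (InPsdc2 x0 y × (∀ k e → xs k e ≡ (y k e true + y k e false) - x0 e))

-- Given y ∈ P_sdc2, split the capacity x⁰ₑ ≤ yᵏᵢⱼ + yᵏⱼᵢ between the two arcs of e and
-- let zᵏ be what remains of yᵏ: then zᵏᵢⱼ + zᵏⱼᵢ = yᵏᵢⱼ + yᵏⱼᵢ − x⁰ₑ and yᵏ ≤ x⁰ + zᵏ arcwise,
-- so every directed cut of yᵏ is dominated by the corresponding cut of x⁰ + zᵏ.
-- Conversely every point of proj(P_sdc2) has x⁰ₑ + xᵏₑ = yᵏᵢⱼ + yᵏⱼᵢ ≤ 1, while on a single
-- edge x⁰ = x¹ = 1 lies in proj(P_sdc1) (take z¹ = 1 on the arc leaving the root).
module Submission where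

open import Defs
open import Data.Nat using (zero; suc; z≤n; s≤s)
open import Data.Fin using (Fin; zero; suc)
open import Data.Bool using (Bool; true; false; if_then_else_)
open import Data.Product using (_×_; _,_; proj₁; ∃-syntax)
open import Data.Sum using (inj₁; inj₂)
open import Data.Vec using (_∷_; []; here; there)
open import Data.Fin.Subset using (inside)
open import Data.Rational using (ℚ; 0ℚ; 1ℚ; _+_; _-_; -_; _≤_; _≤?_)
open import Data.Rational.Properties
open import Data.Rational.Solver using (module +-*-Solver)
open import Data.Unit using (tt)
open import Data.Empty using (⊥-elim)
open import Relation.Binary.PropositionalEquality using (_≡_; refl; sym; cong; subst; subst₂; module ≡-Reasoning)
open import Relation.Nullary using (¬_)
open import Relation.Nullary.Decidable using (toWitness; toWitnessFalse)
open +-*-Solver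

0≤1 : 0ℚ ≤ 1ℚ
0≤1 = toWitness {a? = 0ℚ ≤? 1ℚ} tt

p≤p+q : ∀ p {q} → 0ℚ ≤ q → p ≤ p + q
p≤p+q p 0≤q = subst (_≤ p + _) (+-identityʳ p) (+-monoʳ-≤ p 0≤q)

p≤q+p : ∀ p {q} → 0ℚ ≤ q → p ≤ q + p
p≤q+p p {q} 0≤q = subst (p ≤_) (+-comm p q) (p≤p+q p 0≤q)

p-q≤p : ∀ p {q} → 0ℚ ≤ q → p - q ≤ p
p-q≤p p {q} 0≤q = subst₂ _≤_ (+-identityʳ (p - q)) (solve 2 (λ p q → p :- q :+ q := p) refl p q)
                         (+-monoʳ-≤ (p - q) 0≤q)

p≤q⇒0≤q-p : ∀ {p q} → p ≤ q → 0ℚ ≤ q - p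
p≤q⇒0≤q-p {p} {q} p≤q = subst (_≤ q - p) (+-inverseʳ p) (+-monoˡ-≤ (- p) p≤q)

sumFin-mono : ∀ m {f g : Fin m → ℚ} → (∀ i → f i ≤ g i) → sumFin m f ≤ sumFin m g
sumFin-mono zero    f≤g = ≤-refl
sumFin-mono (suc m) f≤g = +-mono-≤ (f≤g zero) (sumFin-mono m (λ i → f≤g (suc i)))

if-then-0-mono : ∀ c {p q} → p ≤ q → (if c then p else 0ℚ) ≤ (if c then q else 0ℚ)
if-then-0-mono true  p≤q = p≤q
if-then-0-mono false p≤q = ≤-refl

sumBool-mono : ∀ {f g : Bool → ℚ} → (∀ b → f b ≤ g b) → sumBool f ≤ sumBool g
sumBool-mono f≤g = +-mono-≤ (f≤g true) (f≤g false)

≤-sumBool : ∀ {f : Bool → ℚ} → (∀ b → 0ℚ ≤ f b) → ∀ b → f b ≤ sumBool f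
≤-sumBool f≥0 true  = p≤p+q _ (f≥0 false)
≤-sumBool f≥0 false = p≤q+p _ (f≥0 true)

record Residual (y : Bool → ℚ) (c : ℚ) : Set where
  field
    z        : Bool → ℚ
    z≥0      : ∀ b → 0ℚ ≤ z b
    y≤c+z    : ∀ b → y b ≤ c + z b
    Σz≡Σy-c  : sumBool z ≡ sumBool y - c

residual : (y : Bool → ℚ) (c : ℚ) → (∀ b → 0ℚ ≤ y b) → 0ℚ ≤ c → c ≤ sumBool y → Residual y c
residual y c y≥0 c≥0 c≤Σy with ≤-total c (y true)
... | inj₁ c≤y₁ = record
  { z = λ { true → y true - c ; false → y false }
  ; z≥0 = λ { true → p≤q⇒0≤q-p c≤y₁ ; false → y≥0 false }
  ; y≤c+z = λ { true  → ≤-reflexive (solve 2 (λ a c → a := c :+ (a :- c)) refl (y true) c)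
              ; false → p≤q+p (y false) c≥0 }
  ; Σz≡Σy-c = solve 3 (λ a b c → a :- c :+ b := a :+ b :- c) refl (y true) (y false) c
  }
... | inj₂ y₁≤c = record
  { z = λ { true → 0ℚ ; false → sumBool y - c }
  ; z≥0 = λ { true → ≤-refl ; false → p≤q⇒0≤q-p c≤Σy }
  ; y≤c+z = λ { true  → subst (y true ≤_) (sym (+-identityʳ c)) y₁≤c
              ; false → subst (y false ≤_) (solve 3 (λ a b c → a :+ b := c :+ (a :+ b :- c)) refl (y true) (y false) c)
                              (p≤q+p (y false) (y≥0 true)) }
  ; Σz≡Σy-c = +-identityˡ _
  }

module _ (I : SSTP) where
  open SSTP I

  δ⁻sum-mono : ∀ S {f g : Fin m → Bool → ℚ} → (∀ e b → f e b ≤ g e b) → δ⁻sum S f ≤ δ⁻sum S g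
  δ⁻sum-mono S f≤g = sumFin-mono m λ e → sumBool-mono λ b → if-then-0-mono (inδ⁻ S e b) (f≤g e b)

  proj2⊆proj1 : (x0 : Fin m → ℚ) (xs : Fin K → Fin m → ℚ) → InProj2 x0 xs → InProj1 x0 xs
  proj2⊆proj1 x0 xs (y , (x0∈01 , y∈01 , y-cut , x0≤Σy , Σy≤1) , xs≡) =
    z , (x0∈01 , z∈01 , z-cut , Σz≤1) , λ k e → subst (xs k e ≡_) (sym (Σz≡Σy-c k e)) (xs≡ k e)
    where
      res : ∀ k e → Residual (y k e) (x0 e)
      res k e = residual (y k e) (x0 e) (λ b → proj₁ (y∈01 k e b)) (proj₁ (x0∈01 e)) (x0≤Σy k e)
      open module Res k e = Residual (res k e)
      Σz≤1 : ∀ k e → sumBool (z k e) ≤ 1ℚ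
      Σz≤1 k e = subst (_≤ 1ℚ) (sym (Σz≡Σy-c k e)) (≤-trans (p-q≤p _ (proj₁ (x0∈01 e))) (Σy≤1 k e))
      z∈01 : ∀ k e b → InUnit (z k e b)
      z∈01 k e b = z≥0 k e b , ≤-trans (≤-sumBool (z≥0 k e) b) (Σz≤1 k e)
      z-cut : ∀ k S → CutSet k S → 1ℚ ≤ δ⁻sum S (λ e b → x0 e + z k e b)
      z-cut k S cut = ≤-trans (y-cut k S cut) (δ⁻sum-mono S (y≤c+z k))

  proj2-x0+x≤1 : ∀ {x0 xs} → InProj2 x0 xs → ∀ k e → x0 e + xs k e ≤ 1ℚ
  proj2-x0+x≤1 {x0} {xs} (y , (_ , _ , _ , _ , Σy≤1) , xs≡) k e = subst (_≤ 1ℚ) (begin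
      sumBool (y k e)               ≡⟨ solve 2 (λ a c → a := c :+ (a :- c)) refl (sumBool (y k e)) (x0 e) ⟩
      x0 e + (sumBool (y k e) - x0 e) ≡⟨ cong (x0 e +_) (sym (xs≡ k e)) ⟩
      x0 e + xs k e                 ∎) (Σy≤1 k e)
    where open ≡-Reasoning

singleEdge : SSTP
singleEdge = record
  { n = 2 ; m = 1
  ; ends = λ _ → zero , suc zero
  ; noLoop = λ _ ()
  ; simple = λ { zero zero _ → refl }
  ; K = 1 ; K≥1 = s≤s z≤n
  ; T = λ _ → inside ∷ inside ∷ []
  ; r = λ _ → zero
  ; r∈T = λ _ → here
  }

open SSTP singleEdge using (InProj1; InProj2; CutSet; δ⁻sum)

proj1⊄proj2 : InProj1 (λ _ → 1ℚ) (λ _ _ → 1ℚ) × ¬ InProj2 (λ _ → 1ℚ) (λ _ _ → 1ℚ)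
proj1⊄proj2 = (z , ((λ _ → 0≤1 , ≤-refl) , z∈01 , cut , λ { zero zero → ≤-refl }) , λ { zero zero → refl })
            , λ p → toWitnessFalse {a? = 1ℚ + 1ℚ ≤? 1ℚ} tt (proj2-x0+x≤1 singleEdge p zero zero)
  where
    z : Fin 1 → Fin 1 → Bool → ℚ
    z _ _ true  = 1ℚ
    z _ _ false = 0ℚ
    z∈01 : ∀ k e b → 0ℚ ≤ z k e b × z k e b ≤ 1ℚ
    z∈01 _ _ true  = 0≤1 , ≤-refl
    z∈01 _ _ false = ≤-refl , 0≤1
    -- The only cut set is {1}, entered by the single arc (0,1).
    cut : ∀ k S → CutSet k S → 1ℚ ≤ δ⁻sum S (λ e b → 1ℚ + z k e b)
    cut zero (true ∷ _ ∷ [])      (r∉S , _)                = ⊥-elim (r∉S here)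
    cut zero (false ∷ true ∷ [])  _                        = toWitness {a? = 1ℚ ≤? 1ℚ + 1ℚ} tt
    cut zero (false ∷ false ∷ []) (_ , zero , _ , _ , t≢r) = ⊥-elim (t≢r refl)
    cut zero (false ∷ false ∷ []) (_ , suc zero , there () , _)

mainTheorem5 : ((I : SSTP) → (x0 : Fin (SSTP.m I) → ℚ) → (xs : Fin (SSTP.K I) → Fin (SSTP.m I) → ℚ)
                 → SSTP.InProj2 I x0 xs → SSTP.InProj1 I x0 xs)
             × (∃[ I ] ∃[ x0 ] ∃[ xs ] (SSTP.InProj1 I x0 xs × ¬ SSTP.InProj2 I x0 xs))
mainTheorem5 = proj2⊆proj1 , singleEdge , (λ _ → 1ℚ) , (λ _ _ → 1ℚ) , proj1⊄proj2
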